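{- Let $k\ge 3$ be odd and let $P=P_1\cup P_2$ and $Q=Q_1\cup Q_2$ each be a disjoint union of two copies of $K_k$ (so $P=Q=2K_k$, with $P_i,Q_j$ the cliques). If $(P,Q,R)$ is $k$-admissible, then for every $i,j\in\{1,2\}$ the bipartite graph $R[V(P_i),V(Q_j)]$ is a matching; in particular $e(R)\le 4k$. The bound is attained by taking a perfect matching between each pair $V(P_i),V(Q_j)$ (which gives a $k$-admissible triple).
   Context: $\nu(G)$ is the matching number and $\Delta(G)$ the maximum degree. $f(\nu,\Delta)=\max\{e(G):\nu(G)\le\nu,\ \Delta(G)\le\Delta\}$. $\mathcal{P}_k$ is the family of all graphs without isolated vertices with $\nu\le k-1$, $\Delta\le k-1$ and exactly $f(k-1,k-1)$ edges (for odd $k$, $2K_k\in\mathcal{P}_k$). For $P,Q\in\mathcal{P}_k$ with $A=V(P)$, $B=V(Q)$ disjoint and a bipartite graph $R$ with parts $A,B$, the triple $(P,Q,R)$ is $k$-admissible if $d_P(a)+\nu(Q[N_R(a)])\le k-1$ for every $a\in A$ and $d_Q(b)+\nu(P[N_R(b)])\le k-1$ for every $b\in B$. -}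

module Defs where

open import Data.Nat using (ℕ; _∸_; _+_; _≤_)
open import Data.Bool using (Bool; true; false; _∧_; not)
open import Data.Fin using (Fin; _≟_)
open import Data.Fin.Properties using () renaming (_≟_ to _≟ᶠ_)
open import Data.List using (List; []; _∷_; length; filter; cartesianProduct; allFin; concatMap)
open import Data.List.Relation.Unary.All using (All)
open import Data.List.Relation.Unary.Unique.Propositional using (Unique)
open import Data.Product using (_×_; _,_; proj₁; proj₂)
open import Relation.Binary.PropositionalEquality using (_≡_)
open import Relation.Nullary.Decidable using (⌊_⌋)

-- Vertices of 2K_k : Fin 2 × Fin k ; the clique P_i is {i} × Fin k.
Vtx : ℕ → Set
Vtx k = Fin 2 × Fin k

vertices : (k : ℕ) → List (Vtx k)
vertices k = cartesianProduct (allFin 2) (allFin k)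

twoK : (k : ℕ) → Vtx k → Vtx k → Bool
twoK k (i , x) (j , y) = ⌊ i ≟ j ⌋ ∧ not ⌊ x ≟ y ⌋

deg : (k : ℕ) → (Vtx k → Vtx k → Bool) → Vtx k → ℕ
deg k G v = length (filter (λ u → G v u ≡? true) (vertices k))
  where
  open import Data.Bool.Properties using () renaming (_≟_ to _≡?_)

endpoints : {V : Set} → List (V × V) → List V
endpoints = concatMap (λ e → proj₁ e ∷ proj₂ e ∷ [])

IsMatchingIn : {V : Set} → (V → V → Bool) → (V → Bool) → List (V × V) → Set
IsMatchingIn G S M =
  All (λ e → (G (proj₁ e) (proj₂ e) ≡ true) × (S (proj₁ e) ≡ true) × (S (proj₂ e) ≡ true)) M
  × Unique (endpoints M)

νIn≤ : {V : Set} → (V → V → Bool) → (V → Bool) → ℕ → Set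
νIn≤ G S m = ∀ M → IsMatchingIn G S M → length M ≤ m

-- P = Q = 2K_k on disjoint vertex sets A = B = Vtx k (two separate copies);
-- R a b = true means a ∈ A is adjacent to b ∈ B in the bipartite graph R.
-- k-admissibility of (2K_k, 2K_k, R):
--   d_P(a) + ν(Q[N_R(a)]) ≤ k-1 for all a, and symmetrically for b.
Admissible : (k : ℕ) → (Vtx k → Vtx k → Bool) → Set
Admissible k R =
  (∀ a → ∀ M → IsMatchingIn (twoK k) (λ b → R a b) M → deg k (twoK k) a + length M ≤ k ∸ 1)
  × (∀ b → ∀ M → IsMatchingIn (twoK k) (λ a → R a b) M → deg k (twoK k) b + length M ≤ k ∸ 1)

eR : (k : ℕ) → (Vtx k → Vtx k → Bool) → ℕ
eR k R = length (filter (λ p → R (proj₁ p) (proj₂ p) ≡? true) (cartesianProduct (vertices k) (vertices k)))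
  where
  open import Data.Bool.Properties using () renaming (_≟_ to _≡?_)

IsMatchingBetween : (k : ℕ) → (Vtx k → Vtx k → Bool) → Fin 2 → Fin 2 → Set
IsMatchingBetween k R i j =
  (∀ x y y′ → R (i , x) (j , y) ≡ true → R (i , x) (j , y′) ≡ true → y ≡ y′)
  × (∀ y x x′ → R (i , x) (j , y) ≡ true → R (i , x′) (j , y) ≡ true → x ≡ x′)

diagR : (k : ℕ) → Vtx k → Vtx k → Bool
diagR k (i , x) (j , y) = ⌊ x ≟ y ⌋

{-# OPTIONS --safe #-}
module Submission where

-- Every vertex of 2K_k has degree k − 1, so admissibility leaves no room in
-- the neighbourhoods: ν(Q[N_R(a)]) = 0, i.e. N_R(a) is independent in 2K_k,
-- and symmetrically for the vertices of Q.  An independent set of 2K_k meets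
-- each clique in at most one vertex.  This is exactly the statement that
-- every R[V(P_i), V(Q_j)] is a matching, and it gives every vertex of P at
-- most two R-neighbours, whence e(R) ≤ 2 · 2k.  For the diagonal R the
-- neighbourhoods {(0, x), (1, x)} are independent and have exactly two
-- elements, so it is admissible with e(R) = 4k.

open import Defs
open import Data.Bool using (Bool; true; false; not; _∧_)
open import Data.Bool.Properties using (∧-zeroʳ; not-¬) renaming (_≟_ to _≡?_)
open import Data.Fin using (Fin; zero; suc; _≟_)
open import Data.List using (List; []; _∷_; _++_; length; filter; map; allFin; cartesianProduct)
open import Data.List.Properties using (filter-++; filter-none; filter-some; length-++; length-map; length-tabulate; ++-identityʳ)
open import Data.List.Membership.Propositional.Properties using (∈-allFin)
open import Data.List.Relation.Unary.All as All using (All; []; _∷_)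
open import Data.List.Relation.Unary.Any as Any using ()
open import Data.List.Relation.Unary.AllPairs using ([]; _∷_)
open import Data.List.Relation.Unary.Unique.Propositional using (Unique)
open import Data.List.Relation.Unary.Unique.Propositional.Properties using (allFin⁺)
open import Data.Nat using (ℕ; suc; _+_; _*_; _∸_; _%_; _≤_; z≤n)
open import Data.Nat.Properties
  using (≤-trans; ≤-reflexive; ≤-antisym; +-mono-≤; +-monoʳ-≤; +-cancelˡ-≤; +-identityʳ; +-suc; *-comm; *-assoc; m+n∸m≡n; module ≤-Reasoning)
open import Data.Product using (_×_; _,_; proj₁)
open import Function using (_∘_; _⇔_; mk⇔; Equivalence)
open import Relation.Binary.PropositionalEquality using (_≡_; _≢_; refl; sym; trans; cong; cong₂; subst; module ≡-Reasoning)
open import Relation.Nullary using (yes; no; contradiction)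
open import Relation.Nullary.Decidable using (⌊_⌋; isYes≗does; dec-true; dec-false)

open Equivalence using (to; from)

private
  variable
    A B V : Set

-- `deg` and `eR` are definitionally instances of `count`.
count : (A → Bool) → List A → ℕ
count p xs = length (filter (λ x → p x ≡? true) xs)

count-++ : (p : A → Bool) (xs ys : List A) → count p (xs ++ ys) ≡ count p xs + count p ys
count-++ p xs ys = trans (cong length (filter-++ _ xs ys)) (length-++ (filter _ xs))

count-map : (p : B → Bool) (f : A → B) (xs : List A) → count p (map f xs) ≡ count (p ∘ f) xs
count-map p f [] = refl
count-map p f (x ∷ xs) with p (f x)
... | true  = cong suc (count-map p f xs)
... | false = count-map p f xs

count-+-count-not : (p : A → Bool) (xs : List A) → count p xs + count (not ∘ p) xs ≡ length xs
count-+-count-not p [] = refl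
count-+-count-not p (x ∷ xs) with p x
... | true  = cong suc (count-+-count-not p xs)
... | false = trans (+-suc _ _) (cong suc (count-+-count-not p xs))

count-none : {p : A → Bool} {xs : List A} → All (λ x → p x ≡ false) xs → count p xs ≡ 0
count-none none = cong length (filter-none _ (All.map not-¬ none))

count-≤1 : {p : A → Bool} {xs : List A} → Unique xs →
  (∀ {x y} → p x ≡ true → p y ≡ true → x ≡ y) → count p xs ≤ 1
count-≤1 {xs = []} [] _ = z≤n
count-≤1 {p = p} {xs = x ∷ xs} (x∉xs ∷ unique) p-unique with p x in px
... | true  = ≤-reflexive (cong suc (count-none (All.map rejected x∉xs)))
  where
  rejected : ∀ {y} → x ≢ y → p y ≡ false
  rejected {y} x≢y with p y in py
  ... | true  = contradiction (p-unique px py) x≢y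
  ... | false = refl
... | false = count-≤1 unique p-unique

count-cartesianProduct-≤ : (p : A × B → Bool) (xs : List A) (ys : List B) {c : ℕ} →
  (∀ x → count (λ y → p (x , y)) ys ≤ c) → count p (cartesianProduct xs ys) ≤ length xs * c
count-cartesianProduct-≤ p [] ys rows = z≤n
count-cartesianProduct-≤ p (x ∷ xs) ys {c} rows = begin
  count p (map (x ,_) ys ++ cartesianProduct xs ys)          ≡⟨ count-++ p (map (x ,_) ys) _ ⟩
  count p (map (x ,_) ys) + count p (cartesianProduct xs ys) ≡⟨ cong (_+ _) (count-map p (x ,_) ys) ⟩
  count (λ y → p (x , y)) ys + count p (cartesianProduct xs ys)
    ≤⟨ +-mono-≤ (rows x) (count-cartesianProduct-≤ p xs ys rows) ⟩
  c + length xs * c                                          ∎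
  where open ≤-Reasoning

count-cartesianProduct-≡ : (p : A × B → Bool) (xs : List A) (ys : List B) {c : ℕ} →
  (∀ x → count (λ y → p (x , y)) ys ≡ c) → count p (cartesianProduct xs ys) ≡ length xs * c
count-cartesianProduct-≡ p [] ys rows = refl
count-cartesianProduct-≡ p (x ∷ xs) ys {c} rows = begin
  count p (map (x ,_) ys ++ cartesianProduct xs ys)          ≡⟨ count-++ p (map (x ,_) ys) _ ⟩
  count p (map (x ,_) ys) + count p (cartesianProduct xs ys)
    ≡⟨ cong₂ _+_ (trans (count-map p (x ,_) ys) (rows x)) (count-cartesianProduct-≡ p xs ys rows) ⟩
  c + length xs * c                                          ∎
  where open ≡-Reasoning

length-cartesianProduct : (xs : List A) (ys : List B) → length (cartesianProduct xs ys) ≡ length xs * length ys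
length-cartesianProduct [] ys = refl
length-cartesianProduct (x ∷ xs) ys =
  trans (length-++ (map (x ,_) ys)) (cong₂ _+_ (length-map (x ,_) ys) (length-cartesianProduct xs ys))

⌊≟⌋-true : {n : ℕ} {x y : Fin n} → x ≡ y → ⌊ x ≟ y ⌋ ≡ true
⌊≟⌋-true {x = x} {y} x≡y = trans (isYes≗does (x ≟ y)) (dec-true (x ≟ y) x≡y)

⌊≟⌋-false : {n : ℕ} {x y : Fin n} → x ≢ y → ⌊ x ≟ y ⌋ ≡ false
⌊≟⌋-false {x = x} {y} x≢y = trans (isYes≗does (x ≟ y)) (dec-false (x ≟ y) x≢y)

⌊≟⌋-sound : {n : ℕ} {x y : Fin n} → ⌊ x ≟ y ⌋ ≡ true → x ≡ y
⌊≟⌋-sound {x = x} {y} _  with x ≟ y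
⌊≟⌋-sound             _  | yes x≡y = x≡y
⌊≟⌋-sound             () | no _

count-≟-allFin : {k : ℕ} (x : Fin k) → count (λ y → ⌊ x ≟ y ⌋) (allFin k) ≡ 1
count-≟-allFin {k} x = ≤-antisym
  (count-≤1 (allFin⁺ k) (λ x≡y x≡y′ → trans (sym (⌊≟⌋-sound x≡y)) (⌊≟⌋-sound x≡y′)))
  (filter-some _ (Any.map ⌊≟⌋-true (∈-allFin x)))

count-≢-allFin : {k : ℕ} (x : Fin k) → count (λ y → not ⌊ x ≟ y ⌋) (allFin k) ≡ k ∸ 1
count-≢-allFin {k} x = begin
  others           ≡⟨ m+n∸m≡n 1 others ⟨
  1 + others ∸ 1   ≡⟨ cong (λ n → n + others ∸ 1) (count-≟-allFin x) ⟨
  count (λ y → ⌊ x ≟ y ⌋) (allFin k) + others ∸ 1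
                   ≡⟨ cong (_∸ 1) (trans (count-+-count-not _ (allFin k)) (length-tabulate {n = k} _)) ⟩
  k ∸ 1            ∎
  where
  open ≡-Reasoning
  others : ℕ
  others = count (λ y → not ⌊ x ≟ y ⌋) (allFin k)

count-vertices : {k : ℕ} (p : Vtx k → Bool) →
  count p (vertices k) ≡ count (λ y → p (zero , y)) (allFin k) + count (λ y → p (suc zero , y)) (allFin k)
count-vertices {k} p = begin
  count p (map (zero ,_) (allFin k) ++ map (suc zero ,_) (allFin k) ++ [])
    ≡⟨ count-++ p (map (zero ,_) (allFin k)) _ ⟩
  count p (map (zero ,_) (allFin k)) + count p (map (suc zero ,_) (allFin k) ++ [])
    ≡⟨ cong₂ _+_ (count-map p _ (allFin k))
                 (trans (cong (count p) (++-identityʳ (map (suc zero ,_) (allFin k)))) (count-map p _ (allFin k))) ⟩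
  count (λ y → p (zero , y)) (allFin k) + count (λ y → p (suc zero , y)) (allFin k) ∎
  where open ≡-Reasoning

length-vertices-*-2 : (k : ℕ) → length (vertices k) * 2 ≡ 4 * k
length-vertices-*-2 k = begin
  length (vertices k) * 2 ≡⟨ cong (_* 2) (length-cartesianProduct (allFin 2) (allFin k)) ⟩
  2 * length (allFin k) * 2 ≡⟨ cong (λ n → 2 * n * 2) (length-tabulate {n = k} _) ⟩
  2 * k * 2               ≡⟨ *-comm (2 * k) 2 ⟩
  2 * (2 * k)             ≡⟨ *-assoc 2 2 k ⟨
  4 * k                   ∎
  where open ≡-Reasoning

twoK-same-clique : {k : ℕ} (i : Fin 2) {x y : Fin k} → x ≢ y → twoK k (i , x) (i , y) ≡ true
twoK-same-clique i x≢y = cong₂ _∧_ (⌊≟⌋-true {x = i} refl) (cong not (⌊≟⌋-false x≢y))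

twoK-same-position : {k : ℕ} (i j : Fin 2) (x : Fin k) → twoK k (i , x) (j , x) ≡ false
twoK-same-position i j x = trans (cong (λ b → ⌊ i ≟ j ⌋ ∧ not b) (⌊≟⌋-true {x = x} refl)) (∧-zeroʳ _)

deg-twoK : {k : ℕ} (v : Vtx k) → deg k (twoK k) v ≡ k ∸ 1
deg-twoK {k} (zero , x) = begin
  deg k (twoK k) (zero , x)                          ≡⟨ count-vertices (twoK k (zero , x)) ⟩
  count (λ y → not ⌊ x ≟ y ⌋) (allFin k) + count (λ _ → false) (allFin k)
    ≡⟨ cong₂ _+_ (count-≢-allFin x) (count-none (All.universal (λ _ → refl) (allFin k))) ⟩
  k ∸ 1 + 0                                          ≡⟨ +-identityʳ _ ⟩
  k ∸ 1                                              ∎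
  where open ≡-Reasoning
deg-twoK {k} (suc zero , x) = begin
  deg k (twoK k) (suc zero , x)                      ≡⟨ count-vertices (twoK k (suc zero , x)) ⟩
  count (λ _ → false) (allFin k) + count (λ y → not ⌊ x ≟ y ⌋) (allFin k)
    ≡⟨ cong₂ _+_ (count-none (All.universal (λ _ → refl) (allFin k))) (count-≢-allFin x) ⟩
  k ∸ 1                                              ∎
  where open ≡-Reasoning

Independent : (V → V → Bool) → (V → Bool) → Set
Independent G S = ∀ u v → S u ≡ true → S v ≡ true → G u v ≡ false

independent⇒νIn≤0 : {G : V → V → Bool} {S : V → Bool} → Independent G S → νIn≤ G S 0
independent⇒νIn≤0 independent []            _                       = z≤n
independent⇒νIn≤0 independent ((u , v) ∷ _) ((edge , Su , Sv) ∷ _ , _) = contradiction edge (not-¬ (independent u v Su Sv))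

νIn≤0⇒independent : {G : V → V → Bool} {S : V → Bool} → (∀ v → G v v ≡ false) →
  νIn≤ G S 0 → Independent G S
νIn≤0⇒independent {G = G} {S} loopless ν≤0 u v Su Sv with G u v in edge
... | false = refl
... | true  = contradiction (ν≤0 ((u , v) ∷ []) single-edge) λ ()
  where
  u≢v : u ≢ v
  u≢v refl = contradiction edge (not-¬ (loopless u))
  single-edge : IsMatchingIn G S ((u , v) ∷ [])
  single-edge = (edge , Su , Sv) ∷ [] , (u≢v ∷ []) ∷ [] ∷ []

d+νIn≤d⇔νIn≤0 : (d : ℕ) {G : V → V → Bool} {S : V → Bool} →
  (∀ M → IsMatchingIn G S M → d + length M ≤ d) ⇔ νIn≤ G S 0
d+νIn≤d⇔νIn≤0 d = mk⇔
  (λ bound M m → +-cancelˡ-≤ d _ 0 (subst (d + length M ≤_) (sym (+-identityʳ d)) (bound M m)))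
  (λ ν≤0 M m → subst (d + length M ≤_) (+-identityʳ d) (+-monoʳ-≤ d (ν≤0 M m)))

twoK-loopless : {k : ℕ} (v : Vtx k) → twoK k v v ≡ false
twoK-loopless (i , x) = twoK-same-position i i x

deg+νIn≤k∸1⇔independent : {k : ℕ} (v : Vtx k) {S : Vtx k → Bool} →
  (∀ M → IsMatchingIn (twoK k) S M → deg k (twoK k) v + length M ≤ k ∸ 1) ⇔ Independent (twoK k) S
deg+νIn≤k∸1⇔independent {k} v {S} rewrite deg-twoK v = mk⇔
  (νIn≤0⇒independent {G = twoK k} twoK-loopless ∘ to (d+νIn≤d⇔νIn≤0 (k ∸ 1)))
  (from (d+νIn≤d⇔νIn≤0 (k ∸ 1)) ∘ independent⇒νIn≤0 {G = twoK k} {S = S})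

IndependentNeighbourhoods : (k : ℕ) → (Vtx k → Vtx k → Bool) → Set
IndependentNeighbourhoods k R = (∀ a → Independent (twoK k) (R a)) × (∀ b → Independent (twoK k) (λ a → R a b))

admissible⇔independentNeighbourhoods : {k : ℕ} {R : Vtx k → Vtx k → Bool} →
  Admissible k R ⇔ IndependentNeighbourhoods k R
admissible⇔independentNeighbourhoods = mk⇔
  (λ (boundA , boundB) → (λ a → to (deg+νIn≤k∸1⇔independent a) (boundA a))
                       , (λ b → to (deg+νIn≤k∸1⇔independent b) (boundB b)))
  (λ (independentA , independentB) → (λ a → from (deg+νIn≤k∸1⇔independent a) (independentA a))
                                   , (λ b → from (deg+νIn≤k∸1⇔independent b) (independentB b)))

independent-twoK-clique : {k : ℕ} {S : Vtx k → Bool} → Independent (twoK k) S →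
  ∀ {i x y} → S (i , x) ≡ true → S (i , y) ≡ true → x ≡ y
independent-twoK-clique independent {i} {x} {y} Sx Sy with x ≟ y
... | yes x≡y = x≡y
... | no  x≢y = contradiction (twoK-same-clique i x≢y) (not-¬ (independent (i , x) (i , y) Sx Sy))

count-independent-twoK : {k : ℕ} {S : Vtx k → Bool} → Independent (twoK k) S → count S (vertices k) ≤ 2
count-independent-twoK {k} {S} independent = begin
  count S (vertices k)     ≡⟨ count-vertices S ⟩
  count (λ y → S (zero , y)) (allFin k) + count (λ y → S (suc zero , y)) (allFin k)
    ≤⟨ +-mono-≤ (count-≤1 (allFin⁺ k) (independent-twoK-clique independent {zero}))
                (count-≤1 (allFin⁺ k) (independent-twoK-clique independent {suc zero})) ⟩
  1 + 1                    ∎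
  where open ≤-Reasoning

position-determined⇒independent : {k : ℕ} {S : Vtx k → Bool} →
  (∀ {i j x y} → S (i , x) ≡ true → S (j , y) ≡ true → x ≡ y) → Independent (twoK k) S
position-determined⇒independent {k} determined (i , x) (j , y) Sx Sy =
  subst (λ z → twoK k (i , x) (j , z) ≡ false) (determined Sx Sy) (twoK-same-position i j x)

independentNeighbourhoods⇒matchingBetween : {k : ℕ} {R : Vtx k → Vtx k → Bool} →
  IndependentNeighbourhoods k R → (i j : Fin 2) → IsMatchingBetween k R i j
independentNeighbourhoods⇒matchingBetween (independentA , independentB) i j =
  (λ x y y′ → independent-twoK-clique (independentA (i , x)) {j}) ,
  (λ y x x′ → independent-twoK-clique (independentB (j , y)) {i})

eR-≤ : {k : ℕ} (R : Vtx k → Vtx k → Bool) → (∀ a → count (R a) (vertices k) ≤ 2) → eR k R ≤ 4 * k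
eR-≤ {k} R rows =
  ≤-trans (count-cartesianProduct-≤ _ (vertices k) (vertices k) rows) (≤-reflexive (length-vertices-*-2 k))

eR-≡ : {k : ℕ} (R : Vtx k → Vtx k → Bool) → (∀ a → count (R a) (vertices k) ≡ 2) → eR k R ≡ 4 * k
eR-≡ {k} R rows = trans (count-cartesianProduct-≡ _ (vertices k) (vertices k) rows) (length-vertices-*-2 k)

diagR-independentNeighbourhoods : {k : ℕ} → IndependentNeighbourhoods k (diagR k)
diagR-independentNeighbourhoods =
  (λ { (i , x) → position-determined⇒independent {S = diagR _ (i , x)}
                   (λ Sy Sy′ → trans (sym (⌊≟⌋-sound Sy)) (⌊≟⌋-sound Sy′)) }) ,
  (λ { (j , y) → position-determined⇒independent {S = λ a → diagR _ a (j , y)}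
                   (λ Sx Sx′ → trans (⌊≟⌋-sound Sx) (sym (⌊≟⌋-sound Sx′))) })

count-diagR : {k : ℕ} (a : Vtx k) → count (diagR k a) (vertices k) ≡ 2
count-diagR (i , x) = trans (count-vertices (diagR _ (i , x))) (cong₂ _+_ (count-≟-allFin x) (count-≟-allFin x))

proposition5p2 : (k : ℕ) → 3 ≤ k → k % 2 ≡ 1 →
    ((R : Vtx k → Vtx k → Bool) → Admissible k R →
       ((i j : Fin 2) → IsMatchingBetween k R i j) × eR k R ≤ 4 * k)
    × (Admissible k (diagR k) × eR k (diagR k) ≡ 4 * k)
proposition5p2 k _ _ =
  upper-bound ,
  from admissible⇔independentNeighbourhoods diagR-independentNeighbourhoods ,
  eR-≡ (diagR k) count-diagR
  where
  upper-bound : (R : Vtx k → Vtx k → Bool) → Admissible k R →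
    ((i j : Fin 2) → IsMatchingBetween k R i j) × eR k R ≤ 4 * k
  upper-bound R admissible =
    independentNeighbourhoods⇒matchingBetween independent ,
    eR-≤ R (λ a → count-independent-twoK (proj₁ independent a))
    where
    independent : IndependentNeighbourhoods k R
    independent = to admissible⇔independentNeighbourhoods admissible
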